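{- Let $A$ be a unital associative $K$-algebra and $c(t)\in A[[t]]$. (a) If $c(0)=1$, then for $i=1$ and for $i=2$ there exists a unique NCS system over $A$ whose $i$-th component is $c(t)$. (b) If $c(0)=0$, there exists a unique NCS system over $A$ whose third component is $c(t)$. (c) For $i=4$ and for $i=5$ there exists a unique NCS system over $A$ whose $i$-th component is $c(t)$.
   Context: $K$ is a unital commutative $\mathbb{Q}$-algebra; $t$ is a formal central parameter. An NCS system over $A$ is a $5$-tuple $(f(t),g(t),d(t),h(t),m(t))\in A[[t]]^{\times5}$ with $d(0)=0$ satisfying $f(0)=1$; $f(-t)g(t)=g(t)f(-t)=1$; $e^{d(t)}=g(t)$ (with $e^{d(t)}=\sum_{k\ge0}d(t)^k/k!$); $g'(t)=g(t)h(t)$; $g'(t)=m(t)g(t)$, where $'$ denotes $d/dt$. -}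

module Defs where

open import Level using (Level; _⊔_)
open import Data.Nat using (ℕ; zero; suc; _∸_)
open import Data.Product using (Σ; _×_)
open import Algebra.Bundles using (RawRing; Ring; CommutativeRing)
open import Algebra.Morphism.Structures using (module RingMorphisms)

ℕ→R : ∀ {a ℓ} (R : RawRing a ℓ) → ℕ → RawRing.Carrier R
ℕ→R R zero    = RawRing.0# R
ℕ→R R (suc n) = RawRing._+_ R (RawRing.1# R) (ℕ→R R n)

-- K is a Q-algebra: every positive integer is invertible in K
-- (inv n is the inverse of n+1; inverses in a commutative ring are unique)
record IsQAlgebra {c ℓ} (K : CommutativeRing c ℓ) : Set (c ⊔ ℓ) where
  open CommutativeRing K
  field
    inv         : ℕ → Carrier
    inv-correct : ∀ n → (ℕ→R rawRing (suc n) * inv n) ≈ 1#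

record KAlgebra {c ℓ a ℓa} (K : CommutativeRing c ℓ) (A : Ring a ℓa)
       : Set (c ⊔ ℓ ⊔ a ⊔ ℓa) where
  open Ring A hiding (zero)
  field
    φ         : CommutativeRing.Carrier K → Carrier
    φ-hom     : RingMorphisms.IsRingHomomorphism
                  (CommutativeRing.rawRing K) (Ring.rawRing A) φ
    φ-central : ∀ k x → (φ k * x) ≈ (x * φ k)

module NCSTheory {c ℓ a ℓa}
  (K : CommutativeRing c ℓ) (Q : IsQAlgebra K)
  (A : Ring a ℓa) (alg : KAlgebra K A) where

  module K = CommutativeRing K
  open Ring A hiding (zero)
  open KAlgebra alg

  Series : Set a
  Series = ℕ → Carrier

  _≋_ : Series → Series → Set ℓa
  f ≋ g = ∀ n → f n ≈ g n

  sumTo : (ℕ → Carrier) → ℕ → Carrier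
  sumTo h zero    = h zero
  sumTo h (suc n) = sumTo h n + h (suc n)

  oneS : Series
  oneS zero    = 1#
  oneS (suc n) = 0#

  _⊛_ : Series → Series → Series
  (f ⊛ g) n = sumTo (λ i → f i * g (n ∸ i)) n

  powS : Series → ℕ → Series
  powS d zero    = oneS
  powS d (suc k) = d ⊛ powS d k

  invFact : ℕ → K.Carrier
  invFact zero    = K.1#
  invFact (suc k) = IsQAlgebra.inv Q k K.* invFact k

  -- e^{d} = Σ_k d^k / k!  ; for d(0)=0 the n-th coefficient only receives
  -- contributions from k ≤ n, so this finite sum is the exact coefficient.
  expS : Series → Series
  expS d n = sumTo (λ k → φ (invFact k) * powS d k n) n

  deriv : Series → Series
  deriv f n = ℕ→R rawRing (suc n) * f (suc n)

  sign : ℕ → Carrier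
  sign zero    = 1#
  sign (suc n) = - sign n

  negArg : Series → Series
  negArg f n = sign n * f n

  record NCS : Set (a ⊔ ℓa) where
    field
      f g d h m : Series
      d0     : d 0 ≈ 0#
      f0     : f 0 ≈ 1#
      inv-l  : (negArg f ⊛ g) ≋ oneS
      inv-r  : (g ⊛ negArg f) ≋ oneS
      exp-d  : expS d ≋ g
      eq-h   : deriv g ≋ (g ⊛ h)
      eq-m   : deriv g ≋ (m ⊛ g)

  open NCS public

  _≈NCS_ : NCS → NCS → Set ℓa
  S ≈NCS T = (f S ≋ f T) × (g S ≋ g T) × (d S ≋ d T) × (h S ≋ h T) × (m S ≋ m T)

  ∃!NCS : (NCS → Set ℓa) → Set (a ⊔ ℓa)
  ∃!NCS P = Σ NCS P × (∀ S T → P S → P T → S ≈NCS T)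

-- Everything is a recursion on coefficients.  An NCS system is determined by its
-- second component g: f(-t) is the two-sided inverse of g, d = log g is recovered
-- degree by degree from e^d = g because degree n+1 of e^d is d_{n+1} plus terms
-- involving only d_1, …, d_n, and h = g⁻¹ g′, m = g′ g⁻¹.  Conversely every series
-- g with g(0) = 1 occurs, and each of f, d, h, m pins down g: f through inversion,
-- d through exp, and h (resp. m) through the ODE g′ = g h (resp. g′ = m g), whose
-- coefficient recursion divides by n + 1, which is possible since K ⊇ ℚ.

module Submission where

open import Defs
open import Data.Nat using (ℕ; zero; suc; _∸_; _≤_; z≤n; s≤s; _≤?_)
import Data.Nat.Properties as ℕ
open import Data.Product using (_×_; _,_)
open import Data.Sum using (inj₁; inj₂)
open import Data.Empty using (⊥-elim)
open import Relation.Nullary using (yes; no)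
open import Relation.Binary.PropositionalEquality as ≡ using (_≡_)
open import Algebra.Bundles using (Ring; CommutativeRing)
open import Algebra.Morphism.Structures using (module RingMorphisms)

module NCSSystems {c ℓ a ℓa} (K : CommutativeRing c ℓ) (Q : IsQAlgebra K)
  (A : Ring a ℓa) (alg : KAlgebra K A) where

  open NCSTheory K Q A alg
  open Ring A hiding (zero)
  open KAlgebra alg
  open IsQAlgebra Q using (inv; inv-correct)
  open import Algebra.Properties.Ring A
    using (-‿involutive; -‿distribˡ-*; -‿distribʳ-*; //-rightDividesˡ; //-rightDividesʳ)
  open import Algebra.Properties.CommutativeSemigroup +-commutativeSemigroup
    using (interchange)
  open import Relation.Binary.Reasoning.Setoid setoid
  module φ = RingMorphisms.IsRingHomomorphism φ-hom

  ≋-sym : ∀ {s t} → s ≋ t → t ≋ s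
  ≋-sym e n = sym (e n)

  ≋-trans : ∀ {s t u} → s ≋ t → t ≋ u → s ≋ u
  ≋-trans e e′ n = trans (e n) (e′ n)

  infix 4 _≈[≤_]_
  _≈[≤_]_ : Series → ℕ → Series → Set ℓa
  s ≈[≤ n ] t = ∀ i → i ≤ n → s i ≈ t i

  ≈[≤]-refl : ∀ {s n} → s ≈[≤ n ] s
  ≈[≤]-refl _ _ = refl

  ≈[≤]-mono : ∀ {s t m n} → m ≤ n → s ≈[≤ n ] t → s ≈[≤ m ] t
  ≈[≤]-mono m≤n e i i≤m = e i (ℕ.≤-trans i≤m m≤n)

  ≋⇒≈[≤] : ∀ {s t n} → s ≋ t → s ≈[≤ n ] t
  ≋⇒≈[≤] e i _ = e i

  infix 30 _⁺
  _⁺ : Series → Series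
  (s ⁺) i = s (suc i)

  sumTo-cong : ∀ {u v} n → (∀ i → i ≤ n → u i ≈ v i) → sumTo u n ≈ sumTo v n
  sumTo-cong zero    e = e 0 z≤n
  sumTo-cong (suc n) e =
    +-cong (sumTo-cong n (λ i i≤n → e i (ℕ.m≤n⇒m≤1+n i≤n))) (e (suc n) ℕ.≤-refl)

  sumTo-zero : ∀ {u} n → (∀ i → i ≤ n → u i ≈ 0#) → sumTo u n ≈ 0#
  sumTo-zero zero    e = e 0 z≤n
  sumTo-zero (suc n) e =
    trans (+-cong (sumTo-zero n (λ i i≤n → e i (ℕ.m≤n⇒m≤1+n i≤n))) (e (suc n) ℕ.≤-refl))
          (+-identityʳ 0#)

  sumTo-+ : ∀ u v n → sumTo (λ i → u i + v i) n ≈ sumTo u n + sumTo v n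
  sumTo-+ u v zero    = refl
  sumTo-+ u v (suc n) = trans (+-congʳ (sumTo-+ u v n)) (interchange _ _ _ _)

  sumTo-*ˡ : ∀ x u n → sumTo (λ i → x * u i) n ≈ x * sumTo u n
  sumTo-*ˡ x u zero    = refl
  sumTo-*ˡ x u (suc n) = trans (+-congʳ (sumTo-*ˡ x u n)) (sym (distribˡ x _ _))

  sumTo-head : ∀ u n → sumTo u (suc n) ≈ u 0 + sumTo (λ i → u (suc i)) n
  sumTo-head u zero    = refl
  sumTo-head u (suc n) = trans (+-congʳ (sumTo-head u n)) (+-assoc _ _ _)

  ⊛-local : ∀ {s s′ t t′} n → s ≈[≤ n ] s′ → t ≈[≤ n ] t′ → (s ⊛ t) n ≈ (s′ ⊛ t′) n
  ⊛-local n es et = sumTo-cong n (λ i i≤n → *-cong (es i i≤n) (et (n ∸ i) (ℕ.m∸n≤m n i)))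

  ⊛-cong : ∀ {s s′ t t′} → s ≋ s′ → t ≋ t′ → (s ⊛ t) ≋ (s′ ⊛ t′)
  ⊛-cong es et n = ⊛-local n (≋⇒≈[≤] es) (≋⇒≈[≤] et)

  ⊛-congˡ : ∀ s {t t′} → t ≋ t′ → (s ⊛ t) ≋ (s ⊛ t′)
  ⊛-congˡ s et n = ⊛-local n (≈[≤]-refl {s}) (≋⇒≈[≤] et)

  ⊛-congʳ : ∀ {s s′} t → s ≋ s′ → (s ⊛ t) ≋ (s′ ⊛ t)
  ⊛-congʳ t es n = ⊛-local n (≋⇒≈[≤] es) (≈[≤]-refl {t})

  ⊛-suc-head : ∀ s t n → (s ⊛ t) (suc n) ≈ s 0 * t (suc n) + (s ⁺ ⊛ t) n
  ⊛-suc-head s t n = sumTo-head _ n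

  ⊛-suc-last : ∀ s t n → (s ⊛ t) (suc n) ≈ (s ⊛ t ⁺) n + s (suc n) * t 0
  ⊛-suc-last s t n =
    +-cong (sumTo-cong n (λ i i≤n → *-congˡ (reflexive (≡.cong t (ℕ.+-∸-assoc 1 i≤n)))))
           (*-congˡ (reflexive (≡.cong t (ℕ.n∸n≡0 n))))

  ⊛-identityˡ : ∀ s → (oneS ⊛ s) ≋ s
  ⊛-identityˡ s zero    = *-identityˡ (s 0)
  ⊛-identityˡ s (suc n) = begin
    (oneS ⊛ s) (suc n)                ≈⟨ ⊛-suc-head oneS s n ⟩
    1# * s (suc n) + (oneS ⁺ ⊛ s) n
      ≈⟨ +-cong (*-identityˡ _) (sumTo-zero n (λ i _ → zeroˡ _)) ⟩
    s (suc n) + 0#                    ≈⟨ +-identityʳ _ ⟩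
    s (suc n)                         ∎

  ⊛-identityʳ : ∀ s → (s ⊛ oneS) ≋ s
  ⊛-identityʳ s zero    = *-identityʳ (s 0)
  ⊛-identityʳ s (suc n) = begin
    (s ⊛ oneS) (suc n)                ≈⟨ ⊛-suc-last s oneS n ⟩
    (s ⊛ oneS ⁺) n + s (suc n) * 1#
      ≈⟨ +-cong (sumTo-zero n (λ i _ → zeroʳ _)) (*-identityʳ _) ⟩
    0# + s (suc n)                    ≈⟨ +-identityˡ _ ⟩
    s (suc n)                         ∎

  ⊛-distribʳ-+ : ∀ s t u n → ((λ i → s i + t i) ⊛ u) n ≈ (s ⊛ u) n + (t ⊛ u) n
  ⊛-distribʳ-+ s t u n = trans (sumTo-cong n (λ i _ → distribʳ _ _ _)) (sumTo-+ _ _ n)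

  ⊛-*ˡ : ∀ x s u n → ((λ i → x * s i) ⊛ u) n ≈ x * (s ⊛ u) n
  ⊛-*ˡ x s u n = trans (sumTo-cong n (λ i _ → *-assoc _ _ _)) (sumTo-*ˡ x _ n)

  ⊛-assoc : ∀ s t u → ((s ⊛ t) ⊛ u) ≋ (s ⊛ (t ⊛ u))
  ⊛-assoc s t u zero    = *-assoc _ _ _
  ⊛-assoc s t u (suc n) = begin
    ((s ⊛ t) ⊛ u) (suc n)
      ≈⟨ ⊛-suc-head (s ⊛ t) u n ⟩
    (s 0 * t 0) * u (suc n) + ((s ⊛ t) ⁺ ⊛ u) n
      ≈⟨ +-congˡ (⊛-congʳ u (⊛-suc-head s t) n) ⟩
    (s 0 * t 0) * u (suc n) + ((λ i → s 0 * t (suc i) + (s ⁺ ⊛ t) i) ⊛ u) n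
      ≈⟨ +-congˡ (⊛-distribʳ-+ _ _ u n) ⟩
    (s 0 * t 0) * u (suc n) + (((λ i → s 0 * t (suc i)) ⊛ u) n + ((s ⁺ ⊛ t) ⊛ u) n)
      ≈⟨ +-congˡ (+-cong (⊛-*ˡ (s 0) (t ⁺) u n) (⊛-assoc (s ⁺) t u n)) ⟩
    (s 0 * t 0) * u (suc n) + (s 0 * (t ⁺ ⊛ u) n + (s ⁺ ⊛ (t ⊛ u)) n)
      ≈⟨ +-assoc _ _ _ ⟨
    ((s 0 * t 0) * u (suc n) + s 0 * (t ⁺ ⊛ u) n) + (s ⁺ ⊛ (t ⊛ u)) n
      ≈⟨ +-congʳ (trans (+-congʳ (*-assoc _ _ _)) (sym (distribˡ _ _ _))) ⟩
    s 0 * (t 0 * u (suc n) + (t ⁺ ⊛ u) n) + (s ⁺ ⊛ (t ⊛ u)) n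
      ≈⟨ +-congʳ (*-congˡ (⊛-suc-head t u n)) ⟨
    s 0 * (t ⊛ u) (suc n) + (s ⁺ ⊛ (t ⊛ u)) n
      ≈⟨ ⊛-suc-head s (t ⊛ u) n ⟨
    (s ⊛ (t ⊛ u)) (suc n) ∎

  ⊛-inverse-unique : ∀ {x y z} → (x ⊛ y) ≋ oneS → (y ⊛ z) ≋ oneS → x ≋ z
  ⊛-inverse-unique {x} {y} {z} xy≋1 yz≋1 n = begin
    x n                ≈⟨ ⊛-identityʳ x n ⟨
    (x ⊛ oneS) n       ≈⟨ ⊛-congˡ x yz≋1 n ⟨
    (x ⊛ (y ⊛ z)) n    ≈⟨ ⊛-assoc x y z n ⟨
    ((x ⊛ y) ⊛ z) n    ≈⟨ ⊛-congʳ z xy≋1 n ⟩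
    (oneS ⊛ z) n       ≈⟨ ⊛-identityˡ z n ⟩
    z n                ∎

  ⊛-cancel-inverseˡ : ∀ {u g} → (u ⊛ g) ≋ oneS → ∀ x → (u ⊛ (g ⊛ x)) ≋ x
  ⊛-cancel-inverseˡ {u} {g} ug≋1 x n = begin
    (u ⊛ (g ⊛ x)) n    ≈⟨ ⊛-assoc u g x n ⟨
    ((u ⊛ g) ⊛ x) n    ≈⟨ ⊛-congʳ x ug≋1 n ⟩
    (oneS ⊛ x) n       ≈⟨ ⊛-identityˡ x n ⟩
    x n                ∎

  ⊛-cancel-inverseʳ : ∀ {u g} → (u ⊛ g) ≋ oneS → ∀ x → ((x ⊛ u) ⊛ g) ≋ x
  ⊛-cancel-inverseʳ {u} {g} ug≋1 x n = begin
    ((x ⊛ u) ⊛ g) n    ≈⟨ ⊛-assoc x u g n ⟩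
    (x ⊛ (u ⊛ g)) n    ≈⟨ ⊛-congˡ x ug≋1 n ⟩
    (x ⊛ oneS) n       ≈⟨ ⊛-identityʳ x n ⟩
    x n                ∎

  sign*sign : ∀ n → sign n * sign n ≈ 1#
  sign*sign zero    = *-identityˡ 1#
  sign*sign (suc n) = begin
    - sign n * - sign n      ≈⟨ -‿distribˡ-* _ _ ⟨
    - (sign n * - sign n)    ≈⟨ -‿cong (-‿distribʳ-* _ _) ⟨
    - - (sign n * sign n)    ≈⟨ -‿involutive _ ⟩
    sign n * sign n          ≈⟨ sign*sign n ⟩
    1#                       ∎

  negArg-cong : ∀ {s t} → s ≋ t → negArg s ≋ negArg t
  negArg-cong e n = *-congˡ (e n)

  negArg-involutive : ∀ s → negArg (negArg s) ≋ s
  negArg-involutive s n = trans (sym (*-assoc _ _ _)) (trans (*-congʳ (sign*sign n)) (*-identityˡ _))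

  -- approx n already has its final coefficients in degrees 0, …, n.
  module Recursion (b : Carrier) (step : Series → ℕ → Carrier)
                   (step-local : ∀ {s t} n → s ≈[≤ n ] t → step s n ≈ step t n) where

    approx : ℕ → Series
    approx zero    j = b
    approx (suc n) j with j ≤? n
    ... | yes _ = approx n j
    ... | no  _ = step (approx n) n

    series : Series
    series j = approx j j

    approx-suc-≤ : ∀ n j → j ≤ n → approx (suc n) j ≡ approx n j
    approx-suc-≤ n j j≤n with j ≤? n
    ... | yes _  = ≡.refl
    ... | no j≰n = ⊥-elim (j≰n j≤n)

    approx-suc-suc : ∀ n → approx (suc n) (suc n) ≡ step (approx n) n
    approx-suc-suc n with suc n ≤? n
    ... | yes 1+n≤n = ⊥-elim (ℕ.1+n≰n 1+n≤n)
    ... | no  _     = ≡.refl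

    approx-final : ∀ n j → j ≤ n → approx n j ≡ series j
    approx-final zero    zero z≤n = ≡.refl
    approx-final (suc n) j j≤1+n with ℕ.m≤n⇒m<n∨m≡n j≤1+n
    ... | inj₁ (s≤s j≤n) = ≡.trans (approx-suc-≤ n j j≤n) (approx-final n j j≤n)
    ... | inj₂ ≡.refl    = ≡.refl

    series-suc : ∀ n → series (suc n) ≈ step series n
    series-suc n = trans (reflexive (approx-suc-suc n))
                         (step-local n (λ i i≤n → reflexive (approx-final n i i≤n)))

  ≋-by-recursion : ∀ {s t} → s 0 ≈ t 0 → (∀ n → s ≈[≤ n ] t → s (suc n) ≈ t (suc n)) → s ≋ t
  ≋-by-recursion {s} {t} e₀ eₛ n = upTo n n ℕ.≤-refl
    where
    upTo : ∀ n → s ≈[≤ n ] t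
    upTo zero    zero z≤n = e₀
    upTo (suc n) i i≤1+n with ℕ.m≤n⇒m<n∨m≡n i≤1+n
    ... | inj₁ (s≤s i≤n) = upTo n i i≤n
    ... | inj₂ ≡.refl    = eₛ n (upTo n)

  -- A series g with g 0 = 1 has a right inverse r (from g 0 r (n+1) + (g⁺ ⊛ r) n = 0)
  -- and a left inverse l; by associativity they coincide.
  module Inverse (g : Series) (g0 : g 0 ≈ 1#) where

    private
      module Right = Recursion 1# (λ r n → - (g ⁺ ⊛ r) n)
                       (λ n e → -‿cong (⊛-local n (≈[≤]-refl {g ⁺}) e))
      module Left  = Recursion 1# (λ l n → - (l ⊛ g ⁺) n)
                       (λ n e → -‿cong (⊛-local n e (≈[≤]-refl {g ⁺})))

    inverse : Series
    inverse = Right.series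

    inverseʳ : (g ⊛ inverse) ≋ oneS
    inverseʳ zero    = trans (*-congʳ g0) (*-identityˡ 1#)
    inverseʳ (suc n) = begin
      (g ⊛ r) (suc n)                     ≈⟨ ⊛-suc-head g r n ⟩
      g 0 * r (suc n) + (g ⁺ ⊛ r) n       ≈⟨ +-congʳ (*-cong g0 (Right.series-suc n)) ⟩
      1# * - (g ⁺ ⊛ r) n + (g ⁺ ⊛ r) n    ≈⟨ +-congʳ (*-identityˡ _) ⟩
      - (g ⁺ ⊛ r) n + (g ⁺ ⊛ r) n         ≈⟨ -‿inverseˡ _ ⟩
      0#                                  ∎
      where r = inverse

    private
      left⊛g≋1 : (Left.series ⊛ g) ≋ oneS
      left⊛g≋1 zero    = trans (*-congˡ g0) (*-identityˡ 1#)
      left⊛g≋1 (suc n) = begin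
        (l ⊛ g) (suc n)                     ≈⟨ ⊛-suc-last l g n ⟩
        (l ⊛ g ⁺) n + l (suc n) * g 0       ≈⟨ +-congˡ (*-cong (Left.series-suc n) g0) ⟩
        (l ⊛ g ⁺) n + - (l ⊛ g ⁺) n * 1#    ≈⟨ +-congˡ (*-identityʳ _) ⟩
        (l ⊛ g ⁺) n + - (l ⊛ g ⁺) n         ≈⟨ -‿inverseʳ _ ⟩
        0#                                  ∎
        where l = Left.series

    inverseˡ : (inverse ⊛ g) ≋ oneS
    inverseˡ n = trans (⊛-congʳ g (≋-sym (⊛-inverse-unique left⊛g≋1 inverseʳ)) n) (left⊛g≋1 n)

  φ-ℕ→R : ∀ n → φ (ℕ→R K.rawRing n) ≈ ℕ→R rawRing n
  φ-ℕ→R zero    = φ.0#-homo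
  φ-ℕ→R (suc n) = trans (φ.+-homo _ _) (+-cong φ.1#-homo (φ-ℕ→R n))

  [1+_] : ℕ → Carrier
  [1+ n ] = ℕ→R rawRing (suc n)

  [1+_]⁻¹ : ℕ → Carrier
  [1+ n ]⁻¹ = φ (inv n)

  [1+n]*[1+n]⁻¹ : ∀ n → [1+ n ] * [1+ n ]⁻¹ ≈ 1#
  [1+n]*[1+n]⁻¹ n = begin
    [1+ n ] * [1+ n ]⁻¹                       ≈⟨ *-congʳ (φ-ℕ→R (suc n)) ⟨
    φ (ℕ→R K.rawRing (suc n)) * φ (inv n)     ≈⟨ φ.*-homo _ _ ⟨
    φ (ℕ→R K.rawRing (suc n) K.* inv n)       ≈⟨ φ.⟦⟧-cong (inv-correct n) ⟩
    φ K.1#                                    ≈⟨ φ.1#-homo ⟩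
    1#                                        ∎

  [1+n]*x≈y⇒x≈[1+n]⁻¹*y : ∀ {x y} n → [1+ n ] * x ≈ y → x ≈ [1+ n ]⁻¹ * y
  [1+n]*x≈y⇒x≈[1+n]⁻¹*y {x} {y} n e = begin
    x                              ≈⟨ *-identityˡ x ⟨
    1# * x                         ≈⟨ *-congʳ (trans (φ-central _ _) ([1+n]*[1+n]⁻¹ n)) ⟨
    ([1+ n ]⁻¹ * [1+ n ]) * x      ≈⟨ *-assoc _ _ _ ⟩
    [1+ n ]⁻¹ * ([1+ n ] * x)      ≈⟨ *-congˡ e ⟩
    [1+ n ]⁻¹ * y                  ∎

  x≈[1+n]⁻¹*y⇒[1+n]*x≈y : ∀ {x y} n → x ≈ [1+ n ]⁻¹ * y → [1+ n ] * x ≈ y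
  x≈[1+n]⁻¹*y⇒[1+n]*x≈y {x} {y} n e = begin
    [1+ n ] * x                    ≈⟨ *-congˡ e ⟩
    [1+ n ] * ([1+ n ]⁻¹ * y)      ≈⟨ *-assoc _ _ _ ⟨
    ([1+ n ] * [1+ n ]⁻¹) * y      ≈⟨ *-congʳ ([1+n]*[1+n]⁻¹ n) ⟩
    1# * y                         ≈⟨ *-identityˡ y ⟩
    y                              ∎

  deriv-cong : ∀ {s t} → s ≋ t → deriv s ≋ deriv t
  deriv-cong e n = *-congˡ (e (suc n))

  -- G′ = F G with G 0 = 1 (definitionally), solved degree by degree by dividing by n + 1.
  module ODE (F : Series → Series) (F-local : ∀ {G H} n → G ≈[≤ n ] H → F G n ≈ F H n) where

    private
      module Rec = Recursion 1# (λ G n → [1+ n ]⁻¹ * F G n) (λ n e → *-congˡ (F-local n e))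

    solution : Series
    solution = Rec.series

    solution-deriv : deriv solution ≋ F solution
    solution-deriv n = x≈[1+n]⁻¹*y⇒[1+n]*x≈y n (Rec.series-suc n)

    solution-unique : ∀ {G H} → G 0 ≈ H 0 → deriv G ≋ F G → deriv H ≋ F H → G ≋ H
    solution-unique {G} {H} e₀ G′ H′ = ≋-by-recursion e₀ λ n e → begin
      G (suc n)               ≈⟨ [1+n]*x≈y⇒x≈[1+n]⁻¹*y n (G′ n) ⟩
      [1+ n ]⁻¹ * F G n       ≈⟨ *-congˡ (F-local n e) ⟩
      [1+ n ]⁻¹ * F H n       ≈⟨ [1+n]*x≈y⇒x≈[1+n]⁻¹*y n (H′ n) ⟨
      H (suc n)               ∎

  module ODEʳ (s : Series) = ODE (_⊛ s) (λ n e → ⊛-local n e (≈[≤]-refl {s}))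
  module ODEˡ (s : Series) = ODE (s ⊛_) (λ n e → ⊛-local n (≈[≤]-refl {s}) e)

  powS-local : ∀ k {d e} n → d ≈[≤ n ] e → powS d k ≈[≤ n ] powS e k
  powS-local zero    n e i i≤n = refl
  powS-local (suc k) n e i i≤n =
    ⊛-local i (≈[≤]-mono i≤n e) (≈[≤]-mono i≤n (powS-local k n e))

  powS-suc-vanishes : ∀ {d} → d 0 ≈ 0# → ∀ k → powS d (suc k) 0 ≈ 0#
  powS-suc-vanishes d0 k = trans (*-congʳ d0) (zeroˡ _)

  ⊛-vanishing-one : ∀ {d p} → d 0 ≈ 0# → p 0 ≈ 0# → (d ⊛ p) 1 ≈ 0#
  ⊛-vanishing-one d0 p0 =
    trans (+-cong (trans (*-congʳ d0) (zeroˡ _)) (trans (*-congˡ p0) (zeroʳ _))) (+-identityʳ 0#)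

  ⊛-vanishing-suc-suc : ∀ {d p} → d 0 ≈ 0# → p 0 ≈ 0# →
                        ∀ n → (d ⊛ p) (suc (suc n)) ≈ (d ⁺ ⊛ p ⁺) n
  ⊛-vanishing-suc-suc {d} {p} d0 p0 n = begin
    (d ⊛ p) (suc (suc n))
      ≈⟨ ⊛-suc-head d p (suc n) ⟩
    d 0 * p (suc (suc n)) + (d ⁺ ⊛ p) (suc n)
      ≈⟨ +-cong (trans (*-congʳ d0) (zeroˡ _)) (⊛-suc-last (d ⁺) p n) ⟩
    0# + ((d ⁺ ⊛ p ⁺) n + d (suc (suc n)) * p 0)
      ≈⟨ +-identityˡ _ ⟩
    (d ⁺ ⊛ p ⁺) n + d (suc (suc n)) * p 0
      ≈⟨ +-congˡ (trans (*-congˡ p0) (zeroʳ _)) ⟩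
    (d ⁺ ⊛ p ⁺) n + 0#
      ≈⟨ +-identityʳ _ ⟩
    (d ⁺ ⊛ p ⁺) n ∎

  ⊛-vanishing-local : ∀ {d e p q} n → d 0 ≈ 0# → e 0 ≈ 0# → p 0 ≈ 0# → q 0 ≈ 0# →
                      d ≈[≤ n ] e → p ≈[≤ n ] q → (d ⊛ p) (suc n) ≈ (e ⊛ q) (suc n)
  ⊛-vanishing-local {d} {e} {p} {q} zero d0 e0 p0 q0 _ _ =
    trans (⊛-vanishing-one {d} {p} d0 p0) (sym (⊛-vanishing-one {e} {q} e0 q0))
  ⊛-vanishing-local {d} {e} {p} {q} (suc n) d0 e0 p0 q0 de pq = begin
    (d ⊛ p) (suc (suc n))   ≈⟨ ⊛-vanishing-suc-suc {d} {p} d0 p0 n ⟩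
    (d ⁺ ⊛ p ⁺) n           ≈⟨ ⊛-local n (λ i i≤n → de (suc i) (s≤s i≤n))
                                         (λ i i≤n → pq (suc i) (s≤s i≤n)) ⟩
    (e ⁺ ⊛ q ⁺) n           ≈⟨ ⊛-vanishing-suc-suc {e} {q} e0 q0 n ⟨
    (e ⊛ q) (suc (suc n))   ∎

  -- The terms k ≥ 2 of the coefficient expS d (n + 1).
  expTail : Series → ℕ → Carrier
  expTail d zero    = 0#
  expTail d (suc n) =
    sumTo (λ j → φ (invFact (suc (suc j))) * powS d (suc (suc j)) (suc (suc n))) n

  expTail-local : ∀ {d e} n → d 0 ≈ 0# → e 0 ≈ 0# → d ≈[≤ n ] e → expTail d n ≈ expTail e n
  expTail-local zero    d0 e0 de = refl
  expTail-local (suc n) d0 e0 de = sumTo-cong n λ j _ → *-congˡ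
    (⊛-vanishing-local (suc n) d0 e0 (powS-suc-vanishes d0 j) (powS-suc-vanishes e0 j)
      de (powS-local (suc j) (suc n) de))

  φ-invFact-1 : φ (invFact 1) ≈ 1#
  φ-invFact-1 = trans (φ.⟦⟧-cong (K.trans (K.*-identityʳ _) inv0≈1)) φ.1#-homo
    where
    inv0≈1 : inv 0 K.≈ K.1#
    inv0≈1 = K.trans (K.sym (K.*-identityˡ _))
               (K.trans (K.*-congʳ (K.sym (K.+-identityʳ K.1#))) (inv-correct 0))

  expS-zero : ∀ d → expS d 0 ≈ 1#
  expS-zero d = trans (*-identityʳ _) φ.1#-homo

  expS-suc : ∀ d n → expS d (suc n) ≈ d (suc n) + expTail d n
  expS-suc d n = begin
    expS d (suc n)                       ≈⟨ sumTo-head T n ⟩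
    T 0 + sumTo (λ k → T (suc k)) n      ≈⟨ +-congʳ (zeroʳ _) ⟩
    0# + sumTo (λ k → T (suc k)) n       ≈⟨ +-identityˡ _ ⟩
    sumTo (λ k → T (suc k)) n            ≈⟨ split n ⟩
    T 1 + expTail d n
      ≈⟨ +-congʳ (trans (*-cong φ-invFact-1 (⊛-identityʳ d (suc n))) (*-identityˡ _)) ⟩
    d (suc n) + expTail d n              ∎
    where
    T : ℕ → Carrier
    T k = φ (invFact k) * powS d k (suc n)
    split : ∀ m → sumTo (λ k → φ (invFact (suc k)) * powS d (suc k) (suc m)) m
                  ≈ φ (invFact 1) * powS d 1 (suc m) + expTail d m
    split zero    = sym (+-identityʳ _)
    split (suc m) = sumTo-head _ m

  expS-cong : ∀ {d e} → d ≋ e → expS d ≋ expS e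
  expS-cong de n = sumTo-cong n λ k _ → *-congˡ (powS-local k n (≋⇒≈[≤] de) n ℕ.≤-refl)

  expS-injective : ∀ {d e} → d 0 ≈ 0# → e 0 ≈ 0# → expS d ≋ expS e → d ≋ e
  expS-injective {d} {e} d0 e0 exp-de = ≋-by-recursion (trans d0 (sym e0)) λ n de → begin
    d (suc n)
      ≈⟨ //-rightDividesʳ (expTail d n) _ ⟨
    d (suc n) + expTail d n - expTail d n
      ≈⟨ +-cong (sym (expS-suc d n)) (-‿cong (expTail-local n d0 e0 de)) ⟩
    expS d (suc n) - expTail e n
      ≈⟨ +-congʳ (trans (exp-de (suc n)) (expS-suc e n)) ⟩
    e (suc n) + expTail e n - expTail e n
      ≈⟨ //-rightDividesʳ (expTail e n) _ ⟩
    e (suc n) ∎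

  -- Replacing the constant term by 0 makes the recursion step below local for all
  -- series, not only for those vanishing at 0.
  dropConstant : Series → Series
  dropConstant s zero    = 0#
  dropConstant s (suc n) = s (suc n)

  dropConstant-local : ∀ {s t} n → s ≈[≤ n ] t → dropConstant s ≈[≤ n ] dropConstant t
  dropConstant-local n e zero    _   = refl
  dropConstant-local n e (suc i) i≤n = e (suc i) i≤n

  dropConstant-vanishing : ∀ {s} n → s 0 ≈ 0# → s ≈[≤ n ] dropConstant s
  dropConstant-vanishing n s0 zero    _ = s0
  dropConstant-vanishing n s0 (suc i) _ = refl

  module Log (g : Series) (g0 : g 0 ≈ 1#) where

    private
      module Rec = Recursion 0# (λ s n → g (suc n) - expTail (dropConstant s) n)
        (λ n e → +-congˡ (-‿cong (expTail-local n refl refl (dropConstant-local n e))))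

    log : Series
    log = Rec.series

    expS-log : expS log ≋ g
    expS-log zero    = trans (expS-zero log) (sym g0)
    expS-log (suc n) = begin
      expS log (suc n)                  ≈⟨ expS-suc log n ⟩
      log (suc n) + expTail log n
        ≈⟨ +-cong (Rec.series-suc n) (expTail-local n refl refl (dropConstant-vanishing n refl)) ⟩
      g (suc n) - E + E                 ≈⟨ //-rightDividesˡ E _ ⟩
      g (suc n)                         ∎
      where E = expTail (dropConstant log) n

  ncsOf : (G : Series) → G 0 ≈ 1# → NCS
  ncsOf G G0 = record
    { f     = negArg u
    ; g     = G
    ; d     = Log.log G G0
    ; h     = u ⊛ deriv G
    ; m     = deriv G ⊛ u
    ; d0    = refl
    ; f0    = *-identityˡ 1#
    ; inv-l = ≋-trans (⊛-congʳ G (negArg-involutive u)) inverseˡ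
    ; inv-r = ≋-trans (⊛-congˡ G (negArg-involutive u)) inverseʳ
    ; exp-d = Log.expS-log G G0
    ; eq-h  = ≋-sym (⊛-cancel-inverseˡ {G} {u} inverseʳ (deriv G))
    ; eq-m  = ≋-sym (⊛-cancel-inverseʳ {u} {G} inverseˡ (deriv G))
    }
    where open Inverse G G0 renaming (inverse to u)

  g-zero : (S : NCS) → g S 0 ≈ 1#
  g-zero S = trans (sym (exp-d S 0)) (expS-zero (d S))

  h≋f[-t]⊛g′ : (S : NCS) → h S ≋ (negArg (f S) ⊛ deriv (g S))
  h≋f[-t]⊛g′ S = ≋-trans (≋-sym (⊛-cancel-inverseˡ {negArg (f S)} {g S} (inv-l S) (h S)))
                         (⊛-congˡ (negArg (f S)) (≋-sym (eq-h S)))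

  m≋g′⊛f[-t] : (S : NCS) → m S ≋ (deriv (g S) ⊛ negArg (f S))
  m≋g′⊛f[-t] S = ≋-trans (≋-sym (⊛-cancel-inverseʳ {g S} {negArg (f S)} (inv-r S) (m S)))
                         (⊛-congʳ (negArg (f S)) (≋-sym (eq-m S)))

  ≈NCS-from-g : (S T : NCS) → g S ≋ g T → S ≈NCS T
  ≈NCS-from-g S T gS≋gT = fS≋fT , gS≋gT , dS≋dT , hS≋hT , mS≋mT
    where
    f[-t]S≋f[-t]T : negArg (f S) ≋ negArg (f T)
    f[-t]S≋f[-t]T = ⊛-inverse-unique (≋-trans (⊛-congˡ (negArg (f S)) (≋-sym gS≋gT)) (inv-l S))
                                     (inv-r T)
    fS≋fT : f S ≋ f T
    fS≋fT = ≋-trans (≋-sym (negArg-involutive (f S)))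
              (≋-trans (negArg-cong f[-t]S≋f[-t]T) (negArg-involutive (f T)))
    dS≋dT : d S ≋ d T
    dS≋dT = expS-injective (d0 S) (d0 T)
              (≋-trans (exp-d S) (≋-trans gS≋gT (≋-sym (exp-d T))))
    hS≋hT : h S ≋ h T
    hS≋hT = ≋-trans (h≋f[-t]⊛g′ S)
              (≋-trans (⊛-cong f[-t]S≋f[-t]T (deriv-cong gS≋gT)) (≋-sym (h≋f[-t]⊛g′ T)))
    mS≋mT : m S ≋ m T
    mS≋mT = ≋-trans (m≋g′⊛f[-t] S)
              (≋-trans (⊛-cong (deriv-cong gS≋gT) f[-t]S≋f[-t]T) (≋-sym (m≋g′⊛f[-t] T)))

  ∃!NCS-from-g : ∀ {P : NCS → Set ℓa} (G : Series) (G0 : G 0 ≈ 1#) → P (ncsOf G G0) →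
                 (∀ S T → P S → P T → g S ≋ g T) → ∃!NCS P
  ∃!NCS-from-g G G0 PG g-unique =
    (ncsOf G G0 , PG) , λ S T PS PT → ≈NCS-from-g S T (g-unique S T PS PT)

  ∃!NCS-f : ∀ s → s 0 ≈ 1# → ∃!NCS (λ S → f S ≋ s)
  ∃!NCS-f s s0 = ∃!NCS-from-g G refl fG≋s λ S T fS≋s fT≋s →
    ⊛-inverse-unique (inv-r S)
      (≋-trans (⊛-congʳ (g T) (negArg-cong (≋-trans fS≋s (≋-sym fT≋s)))) (inv-l T))
    where
    ns0 : negArg s 0 ≈ 1#
    ns0 = trans (*-identityˡ _) s0
    G : Series
    G = Inverse.inverse (negArg s) ns0
    fG≋s : negArg (Inverse.inverse G refl) ≋ s
    fG≋s = ≋-trans (negArg-cong (⊛-inverse-unique (Inverse.inverseˡ G refl)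
                                                   (Inverse.inverseˡ (negArg s) ns0)))
                   (negArg-involutive s)

  ∃!NCS-g : ∀ s → s 0 ≈ 1# → ∃!NCS (λ S → g S ≋ s)
  ∃!NCS-g s s0 = ∃!NCS-from-g s s0 (λ _ → refl) λ S T gS≋s gT≋s → ≋-trans gS≋s (≋-sym gT≋s)

  ∃!NCS-d : ∀ s → s 0 ≈ 0# → ∃!NCS (λ S → d S ≋ s)
  ∃!NCS-d s s0 = ∃!NCS-from-g (expS s) (expS-zero s)
    (expS-injective refl s0 (Log.expS-log (expS s) (expS-zero s))) λ S T dS≋s dT≋s →
    ≋-trans (≋-sym (exp-d S)) (≋-trans (expS-cong (≋-trans dS≋s (≋-sym dT≋s))) (exp-d T))

  ∃!NCS-h : ∀ s → ∃!NCS (λ S → h S ≋ s)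
  ∃!NCS-h s = ∃!NCS-from-g G refl hG≋s λ S T hS≋s hT≋s →
    ODEʳ.solution-unique s (trans (g-zero S) (sym (g-zero T)))
      (≋-trans (eq-h S) (⊛-congˡ (g S) hS≋s)) (≋-trans (eq-h T) (⊛-congˡ (g T) hT≋s))
    where
    G : Series
    G = ODEʳ.solution s
    open Inverse G refl using (inverse; inverseˡ)
    hG≋s : (inverse ⊛ deriv G) ≋ s
    hG≋s = ≋-trans (⊛-congˡ inverse (ODEʳ.solution-deriv s))
                   (⊛-cancel-inverseˡ {inverse} {G} inverseˡ s)

  ∃!NCS-m : ∀ s → ∃!NCS (λ S → m S ≋ s)
  ∃!NCS-m s = ∃!NCS-from-g G refl mG≋s λ S T mS≋s mT≋s →
    ODEˡ.solution-unique s (trans (g-zero S) (sym (g-zero T)))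
      (≋-trans (eq-m S) (⊛-congʳ (g S) mS≋s)) (≋-trans (eq-m T) (⊛-congʳ (g T) mT≋s))
    where
    G : Series
    G = ODEˡ.solution s
    open Inverse G refl using (inverse; inverseʳ)
    mG≋s : (deriv G ⊛ inverse) ≋ s
    mG≋s = ≋-trans (⊛-congʳ inverse (ODEˡ.solution-deriv s))
                   (⊛-cancel-inverseʳ {G} {inverse} inverseʳ s)

corollary2p6 : ∀ {c ℓ a ℓa} (K : CommutativeRing c ℓ) (Q : IsQAlgebra K)
    (A : Ring a ℓa) (alg : KAlgebra K A) →
    let open NCSTheory K Q A alg
    in (∀ (s : Series) → Ring._≈_ A (s 0) (Ring.1# A) → ∃!NCS (λ S → f S ≋ s))
    × (∀ (s : Series) → Ring._≈_ A (s 0) (Ring.1# A) → ∃!NCS (λ S → g S ≋ s))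
    × (∀ (s : Series) → Ring._≈_ A (s 0) (Ring.0# A) → ∃!NCS (λ S → d S ≋ s))
    × (∀ (s : Series) → ∃!NCS (λ S → h S ≋ s))
    × (∀ (s : Series) → ∃!NCS (λ S → m S ≋ s))
corollary2p6 K Q A alg = ∃!NCS-f , ∃!NCS-g , ∃!NCS-d , ∃!NCS-h , ∃!NCS-m
  where open NCSSystems K Q A alg
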